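{- Let $\bm\lambda=(R_1,\dots,R_n)$ be a horizontal-strip and suppose the pair of rows $(R_i,R_j)$ is strict. Then $R_i\nleftrightarrow R_j$.
   Context: A row is $R=a/b=\{(1,j):b+1\le j\le a\}$ ($a\ge b\ge0$ integers); $l(R)=b$, $|R|$ its number of cells, $R^+=(a+1)/(b+1)$. For rows $R,R'$: $M(R,R')=|R\cap R'|$ if $l(R)\le l(R')$, else $|R\cap R'^+|$. Rows commute, $R\leftrightarrow R'$, if $M(R,R')=M(R',R)$, else $R\nleftrightarrow R'$. For a horizontal-strip (sequence of rows) $(R_1,\dots,R_n)$, $M_{i,j}=M(R_{\min(i,j)},R_{\max(i,j)})$ for $i\ne j$. A pair $(R_i,R_j)$ with $i<j$ and $l(R_i)<l(R_j)$ is strict if either $0<M_{i,j}<\min\{|R_i|,|R_j|\}$, or $M_{i,j}=0$ and $M_{i,k}+M_{j,k}\ge|R_k|+1$ for some index $k\notin\{i,j\}$. -}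

module Defs where

open import Data.Nat using (ℕ; zero; suc; _+_; _∸_; _≤_; _<_; _⊓_; _⊔_; _≤?_)
open import Data.Fin using (Fin) renaming (_<_ to _<ᶠ_; _≤?_ to _≤ᶠ?_)
open import Data.Bool using (if_then_else_)
open import Data.Product using (_×_; ∃-syntax)
open import Data.Sum using (_⊎_)
open import Relation.Nullary using (¬_)
open import Relation.Nullary.Decidable using (⌊_⌋)
open import Relation.Binary.PropositionalEquality using (_≡_; _≢_)

-- A row a/b = {(1,j) : b+1 ≤ j ≤ a} with a ≥ b ≥ 0.
record Row : Set where
  constructor _/_⟨_⟩
  field
    top  : ℕ
    bot  : ℕ
    b≤a  : bot ≤ top
open Row public

l : Row → ℕ
l R = bot R

∣_∣ʳ : Row → ℕ
∣ R ∣ʳ = top R ∸ bot R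

_⁺ : Row → Row
(a / b ⟨ p ⟩) ⁺ = suc a / suc b ⟨ Data.Nat.s≤s p ⟩

-- |R ∩ R'| : cells j with max(b,b')+1 ≤ j ≤ min(a,a')
∣_∩_∣ : Row → Row → ℕ
∣ R ∩ R' ∣ = (top R ⊓ top R') ∸ (bot R ⊔ bot R')

M : Row → Row → ℕ
M R R' = if ⌊ l R ≤? l R' ⌋ then ∣ R ∩ R' ∣ else ∣ R ∩ (R' ⁺) ∣

_↔ʳ_ : Row → Row → Set
R ↔ʳ R' = M R R' ≡ M R' R

-- A horizontal-strip (R_1,…,R_n), indexed by Fin n (0-based).
HStrip : ℕ → Set
HStrip n = Fin n → Row

-- M_{i,j} = M(R_min(i,j), R_max(i,j))   (used only for i ≠ j)
Mᵢⱼ : ∀ {n} → HStrip n → Fin n → Fin n → ℕ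
Mᵢⱼ s i j = if ⌊ i ≤ᶠ? j ⌋ then M (s i) (s j) else M (s j) (s i)

Strict : ∀ {n} → HStrip n → Fin n → Fin n → Set
Strict {n} s i j =
  i <ᶠ j × l (s i) < l (s j) ×
  ( (0 < Mᵢⱼ s i j × Mᵢⱼ s i j < (∣ s i ∣ʳ ⊓ ∣ s j ∣ʳ))
  ⊎ (Mᵢⱼ s i j ≡ 0 ×
     ∃[ k ] (k ≢ i × k ≢ j × suc ∣ s k ∣ʳ ≤ Mᵢⱼ s i k + Mᵢⱼ s j k)) )

{-# OPTIONS --safe #-}
module Submission where

open import Defs
open import Data.Nat using (ℕ; suc; _+_; _∸_; _≤_; _<_; _⊓_; _⊔_; _≤?_)
open import Data.Nat.Properties
open import Data.Fin using (Fin) renaming (_<_ to _<ᶠ_; _≤?_ to _≤ᶠ?_)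
open import Data.Product using (_,_)
open import Data.Sum using (_⊎_; inj₁; inj₂; [_,_]′)
open import Data.Empty using (⊥-elim)
open import Relation.Nullary using (¬_; yes; no)
open import Relation.Binary.PropositionalEquality using (_≡_; refl; sym; trans; cong; subst)

-- Idea: take l(Rᵢ) < l(Rⱼ), so Mᵢⱼ = |Rᵢ ∩ Rⱼ| while M(Rⱼ,Rᵢ) = |Rⱼ ∩ Rᵢ⁺|.
-- Shifting Rᵢ one column right changes a partial overlap by exactly one cell,
-- so commuting rows overlap either fully or not at all. In the latter case
-- Rⱼ is empty or lies strictly to the right of Rᵢ⁺; then the cells of any Rₖ
-- counted by Mᵢₖ and by Mⱼₖ lie in disjoint column windows, so
-- Mᵢₖ + Mⱼₖ ≤ |Rₖ|.

cellsUpTo : Row → ℕ → ℕ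
cellsUpTo K p = (top K ⊓ p) ∸ bot K

cellsAfter : Row → ℕ → ℕ
cellsAfter K q = top K ∸ (bot K ⊔ q)

∸+∸≤∸ : ∀ {u v t b} → u ≤ t → b ≤ v → u ≤ v → (u ∸ b) + (t ∸ v) ≤ t ∸ b
∸+∸≤∸ {u} {v} {t} {b} u≤t b≤v u≤v with v ≤? t
... | yes v≤t = begin
  (u ∸ b) + (t ∸ v)  ≤⟨ +-monoˡ-≤ (t ∸ v) (∸-monoˡ-≤ b u≤v) ⟩
  (v ∸ b) + (t ∸ v)  ≡⟨ +-comm (v ∸ b) (t ∸ v) ⟩
  (t ∸ v) + (v ∸ b)  ≡⟨ sym (+-∸-assoc (t ∸ v) b≤v) ⟩
  (t ∸ v + v) ∸ b    ≡⟨ cong (_∸ b) (m∸n+n≡m v≤t) ⟩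
  t ∸ b              ∎
  where open ≤-Reasoning
... | no v≰t = begin
  (u ∸ b) + (t ∸ v)  ≡⟨ cong ((u ∸ b) +_) (m≤n⇒m∸n≡0 (<⇒≤ (≰⇒> v≰t))) ⟩
  (u ∸ b) + 0        ≡⟨ +-identityʳ (u ∸ b) ⟩
  u ∸ b              ≤⟨ ∸-monoˡ-≤ b u≤t ⟩
  t ∸ b              ∎
  where open ≤-Reasoning

cellsUpTo+cellsAfter≤∣∣ : ∀ K {p q} → p ≤ q → cellsUpTo K p + cellsAfter K q ≤ ∣ K ∣ʳ
cellsUpTo+cellsAfter≤∣∣ K {p} {q} p≤q =
  ∸+∸≤∸ (m⊓n≤m (top K) p) (m≤m⊔n (bot K) q)
        (≤-trans (m⊓n≤n (top K) p) (≤-trans p≤q (m≤n⊔m (bot K) q)))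

M-≤ : ∀ R R' → l R ≤ l R' → M R R' ≡ ∣ R ∩ R' ∣
M-≤ R R' lR≤lR' with l R ≤? l R'
... | yes _ = refl
... | no lR≰lR' = ⊥-elim (lR≰lR' lR≤lR')

M-> : ∀ R R' → l R' < l R → M R R' ≡ ∣ R ∩ (R' ⁺) ∣
M-> R R' lR'<lR with l R ≤? l R'
... | yes lR≤lR' = ⊥-elim (<⇒≱ lR'<lR lR≤lR')
... | no _ = refl

M≤∣∣ˡ : ∀ R R' → M R R' ≤ ∣ R ∣ʳ
M≤∣∣ˡ R R' with l R ≤? l R'
... | yes _ = ∸-mono (m⊓n≤m (top R) (top R')) (m≤m⊔n (bot R) (bot R'))
... | no _ = ∸-mono (m⊓n≤m (top R) (suc (top R'))) (m≤m⊔n (bot R) (suc (bot R')))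

M≤∣∣ʳ : ∀ R R' → M R R' ≤ ∣ R' ∣ʳ
M≤∣∣ʳ R R' with l R ≤? l R'
... | yes _ = ∸-mono (m⊓n≤n (top R) (top R')) (m≤n⊔m (bot R) (bot R'))
... | no _ = ∸-mono (m⊓n≤n (top R) (suc (top R'))) (m≤n⊔m (bot R) (suc (bot R')))

M≤cellsUpTo-top : ∀ X K → M X K ≤ cellsUpTo K (top X)
M≤cellsUpTo-top X K with l X ≤? l K
... | yes _ = ∸-mono (≤-reflexive (⊓-comm (top X) (top K))) (m≤n⊔m (bot X) (bot K))
... | no _ = ∸-mono (≤-trans (≤-reflexive (⊓-comm (top X) (suc (top K))))
                              (⊓-monoʳ-≤ (suc (top K)) (n≤1+n (top X))))
                    (m≤n⊔m (bot X) (suc (bot K)))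

M≤cellsUpTo-suc-top : ∀ K X → M K X ≤ cellsUpTo K (suc (top X))
M≤cellsUpTo-suc-top K X with l K ≤? l X
... | yes _ = ∸-mono (⊓-monoʳ-≤ (top K) (n≤1+n (top X))) (m≤m⊔n (bot K) (bot X))
... | no _ = ∸-mono ≤-refl (m≤m⊔n (bot K) (suc (bot X)))

M≤cellsAfter-bot : ∀ K X → M K X ≤ cellsAfter K (bot X)
M≤cellsAfter-bot K X with l K ≤? l X
... | yes _ = ∸-mono (m⊓n≤m (top K) (top X)) (≤-refl {bot K ⊔ bot X})
... | no _ = ∸-mono (m⊓n≤m (top K) (suc (top X))) (⊔-monoʳ-≤ (bot K) (n≤1+n (bot X)))

M≤cellsAfter : ∀ X K {q} → q < bot X → M X K ≤ cellsAfter K q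
M≤cellsAfter X K {q} q<bX with l X ≤? l K
... | yes _ = ∸-mono (m⊓n≤n (top X) (top K))
                     (≤-trans (⊔-monoʳ-≤ (bot K) (<⇒≤ q<bX)) (≤-reflexive (⊔-comm (bot K) (bot X))))
... | no _ = ∸-mono (m⊓n≤n (top X) (suc (top K)))
                    (⊔-lub (m≤n⊔m (bot X) (suc (bot K))) (≤-trans q<bX (m≤m⊔n (bot X) (suc (bot K)))))

↔⇒∣∩∣≡∣∩⁺∣ : ∀ R R' → l R < l R' → R ↔ʳ R' → ∣ R ∩ R' ∣ ≡ ∣ R' ∩ (R ⁺) ∣
↔⇒∣∩∣≡∣∩⁺∣ R R' lR<lR' commute =
  trans (sym (M-≤ R R' (<⇒≤ lR<lR'))) (trans commute (M-> R' R lR<lR'))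

↔∧∩-nonempty⇒∣∣≤∣∩∣ : ∀ R R' → l R < l R' → R ↔ʳ R' → 0 < ∣ R ∩ R' ∣ → ∣ R' ∣ʳ ≤ ∣ R ∩ R' ∣
↔∧∩-nonempty⇒∣∣≤∣∩∣ R R' lR<lR' commute =
  by-endpoints (top R) (bot R) (top R') (bot R') lR<lR' (↔⇒∣∩∣≡∣∩⁺∣ R R' lR<lR' commute)
  where
  by-endpoints : ∀ a b c d → b < d → (a ⊓ c) ∸ (b ⊔ d) ≡ (c ⊓ suc a) ∸ (d ⊔ suc b) →
                 0 < (a ⊓ c) ∸ (b ⊔ d) → c ∸ d ≤ (a ⊓ c) ∸ (b ⊔ d)
  by-endpoints a b c d b<d eq 0<meet
    rewrite m≤n⇒m⊔n≡n (<⇒≤ b<d) | m≥n⇒m⊔n≡m b<d with suc a ≤? c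
  -- If a < c, the shifted row gains the cell a + 1 in the overlap.
  ... | yes a<c rewrite m≤n⇒m⊓n≡m (<⇒≤ a<c) | m≥n⇒m⊓n≡n a<c =
    ⊥-elim (<-irrefl (trans eq (+-∸-assoc 1 d≤a)) (n<1+n (a ∸ d)))
    where
    d≤a : d ≤ a
    d≤a = <⇒≤ (m∸n≢0⇒n<m (n>0⇒n≢0 0<meet))
  ... | no a≮c rewrite m≥n⇒m⊓n≡n (≮⇒≥ a≮c) = ≤-refl

↔∧∩-empty⇒⊓≤bot : ∀ R R' → l R < l R' → R ↔ʳ R' → ∣ R ∩ R' ∣ ≡ 0 →
                   top R' ⊓ suc (top R) ≤ bot R'
↔∧∩-empty⇒⊓≤bot R R' lR<lR' commute ∩≡0 = m∸n≡0⇒m≤n (begin-equality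
  (top R' ⊓ suc (top R)) ∸ bot R'                      ≡⟨ cong ((top R' ⊓ suc (top R)) ∸_) (sym (m≥n⇒m⊔n≡m lR<lR')) ⟩
  (top R' ⊓ suc (top R)) ∸ (bot R' ⊔ suc (bot R))     ≡⟨ sym (↔⇒∣∩∣≡∣∩⁺∣ R R' lR<lR' commute) ⟩
  ∣ R ∩ R' ∣                                           ≡⟨ ∩≡0 ⟩
  0                                                    ∎)
  where open ≤-Reasoning

↔∧∩-empty⇒empty⊎separated : ∀ R R' → l R < l R' → R ↔ʳ R' → ∣ R ∩ R' ∣ ≡ 0 →
                            ∣ R' ∣ʳ ≡ 0 ⊎ top R < bot R'
↔∧∩-empty⇒empty⊎separated R R' lR<lR' commute ∩≡0
  with ↔∧∩-empty⇒⊓≤bot R R' lR<lR' commute ∩≡0 | ≤-total (top R') (suc (top R))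
... | ⊓≤d | inj₁ c≤sa = inj₁ (m≤n⇒m∸n≡0 (subst (_≤ bot R') (m≤n⇒m⊓n≡m c≤sa) ⊓≤d))
... | ⊓≤d | inj₂ sa≤c = inj₂ (subst (_≤ bot R') (m≥n⇒m⊓n≡n sa≤c) ⊓≤d)

Mᵢⱼ-ordered : ∀ {n} (s : HStrip n) {i j} → i <ᶠ j → l (s i) ≤ l (s j) → Mᵢⱼ s i j ≡ ∣ s i ∩ s j ∣
Mᵢⱼ-ordered s {i} {j} i<j lᵢ≤lⱼ with i ≤ᶠ? j
... | yes _ = M-≤ (s i) (s j) lᵢ≤lⱼ
... | no i≰j = ⊥-elim (i≰j (<⇒≤ i<j))

Mᵢⱼ≤∣∣ˡ : ∀ {n} (s : HStrip n) i k → Mᵢⱼ s i k ≤ ∣ s i ∣ʳ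
Mᵢⱼ≤∣∣ˡ s i k with i ≤ᶠ? k
... | yes _ = M≤∣∣ˡ (s i) (s k)
... | no _ = M≤∣∣ʳ (s k) (s i)

Mᵢⱼ≤∣∣ʳ : ∀ {n} (s : HStrip n) i k → Mᵢⱼ s i k ≤ ∣ s k ∣ʳ
Mᵢⱼ≤∣∣ʳ s i k with i ≤ᶠ? k
... | yes _ = M≤∣∣ʳ (s i) (s k)
... | no _ = M≤∣∣ˡ (s k) (s i)

empty-row-meets-fit : ∀ {n} (s : HStrip n) {j} → ∣ s j ∣ʳ ≡ 0 →
                      ∀ i k → Mᵢⱼ s i k + Mᵢⱼ s j k ≤ ∣ s k ∣ʳ
empty-row-meets-fit s {j} ∣Rⱼ∣≡0 i k = begin
  Mᵢⱼ s i k + Mᵢⱼ s j k  ≤⟨ +-mono-≤ (Mᵢⱼ≤∣∣ʳ s i k) (Mᵢⱼ≤∣∣ˡ s j k) ⟩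
  ∣ s k ∣ʳ + ∣ s j ∣ʳ     ≡⟨ cong (∣ s k ∣ʳ +_) ∣Rⱼ∣≡0 ⟩
  ∣ s k ∣ʳ + 0            ≡⟨ +-identityʳ ∣ s k ∣ʳ ⟩
  ∣ s k ∣ʳ                ∎
  where open ≤-Reasoning

separated-rows-meets-fit : ∀ {n} (s : HStrip n) {i j} → i <ᶠ j → top (s i) < bot (s j) →
                           ∀ k → Mᵢⱼ s i k + Mᵢⱼ s j k ≤ ∣ s k ∣ʳ
separated-rows-meets-fit s {i} {j} i<j a<d k with i ≤ᶠ? k | j ≤ᶠ? k
... | yes _ | yes _ = ≤-trans (+-mono-≤ (M≤cellsUpTo-top (s i) (s k)) (M≤cellsAfter (s j) (s k) a<d))
                              (cellsUpTo+cellsAfter≤∣∣ (s k) ≤-refl)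
... | yes _ | no _ = ≤-trans (+-mono-≤ (M≤cellsUpTo-top (s i) (s k)) (M≤cellsAfter-bot (s k) (s j)))
                             (cellsUpTo+cellsAfter≤∣∣ (s k) (<⇒≤ a<d))
... | no i≰k | yes j≤k = ⊥-elim (i≰k (≤-trans (<⇒≤ i<j) j≤k))
... | no _ | no _ = ≤-trans (+-mono-≤ (M≤cellsUpTo-suc-top (s k) (s i)) (M≤cellsAfter-bot (s k) (s j)))
                            (cellsUpTo+cellsAfter≤∣∣ (s k) a<d)

proposition5p23 : (n : ℕ) (s : HStrip n) (i j : Fin n) →
                  Strict s i j → ¬ (s i ↔ʳ s j)
proposition5p23 n s i j (i<j , lᵢ<lⱼ , inj₁ (0<meet , meet<min)) commute =
  <⇒≱ meet<min (begin
    ∣ s i ∣ʳ ⊓ ∣ s j ∣ʳ  ≤⟨ m⊓n≤n ∣ s i ∣ʳ ∣ s j ∣ʳ ⟩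
    ∣ s j ∣ʳ             ≤⟨ ↔∧∩-nonempty⇒∣∣≤∣∩∣ (s i) (s j) lᵢ<lⱼ commute (subst (0 <_) meet≡∩ 0<meet) ⟩
    ∣ s i ∩ s j ∣        ≡⟨ sym meet≡∩ ⟩
    Mᵢⱼ s i j            ∎)
  where
  open ≤-Reasoning
  meet≡∩ : Mᵢⱼ s i j ≡ ∣ s i ∩ s j ∣
  meet≡∩ = Mᵢⱼ-ordered s i<j (<⇒≤ lᵢ<lⱼ)
proposition5p23 n s i j (i<j , lᵢ<lⱼ , inj₂ (meet≡0 , k , _ , _ , overfull)) commute =
  <⇒≱ overfull ([ (λ ∣Rⱼ∣≡0 → empty-row-meets-fit s ∣Rⱼ∣≡0 i k)
                , (λ separated → separated-rows-meets-fit s i<j separated k)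
                ]′ (↔∧∩-empty⇒empty⊎separated (s i) (s j) lᵢ<lⱼ commute ∩≡0))
  where
  ∩≡0 : ∣ s i ∩ s j ∣ ≡ 0
  ∩≡0 = trans (sym (Mᵢⱼ-ordered s i<j (<⇒≤ lᵢ<lⱼ))) meet≡0
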